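{- Let $g,k$ be integers with $2\le k<g$ and let $m\ge2$ be an integer. Then $Y(g,k)$ is a complete Young graph on $m$ nodes (i.e. $Y(g,k)\in K_m$) if and only if there are exactly $m-1$ positive integers $s$ with $s\le k-1$ such that $s\,\frac{g-k}{k^2-1}$ is an integer.
   Context: Throughout, $g,k$ are integers with $2\le k<g$. The labeled directed graph $H(g,k)$ is built as follows. It has a distinguished starting node $[[0,0]]$ and other nodes labeled by pairs $[R,r]$ of integers with $0\le R,r\le k-1$ (the node $[0,0]$ is distinct from the starting node). For a node $[P,p]$ (the starting node being treated as $[0,0]$ for this purpose) there is an edge labeled $(A,a)$ from $[P,p]$ to $[R,r]$ whenever $A,a$ are integers with $0\le A,a\le g-1$, $0\le R,r\le k-1$, $ka+p=A+rg$ and $kA+R=a+Pg$; edges leaving the starting node additionally require $A\neq0\neq a$; no edge enters the starting node. $H(g,k)$ consists of the starting node and all nodes reachable from it. An even pivot node is a node $[a,a]$; an odd pivot node is a node $[r,s]$ with an edge to $[s,r]$; the starting node is not a pivot node. $Y(g,k)$ is obtained from $H(g,k)$ by deleting every node that is not a pivot node and from which no pivot node is reachable, with the incident edges. $Y(g,k)$ is a complete Young graph on $m$ nodes if its nodes other than the starting node are $m$ nodes forming the complete directed graph on them (an edge from each of these nodes to each of these nodes, including a self-loop at each), and there is an edge from the starting node to every node except $[0,0]$. $K_m$ denotes the class of complete Young graphs on $m$ nodes. -}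

module Defs where

open import Data.Nat using (ℕ; zero; suc; _+_; _*_; _∸_; _<_; _≤_)
open import Data.Nat.Divisibility using (_∣?_)
open import Data.Fin using (Fin; toℕ)
open import Data.Product using (Σ; ∃; _×_; _,_)
open import Data.Sum using (_⊎_)
open import Data.List using (List; length; filter; map; upTo)
open import Data.List.Membership.Propositional using (_∈_)
open import Data.List.Relation.Unary.Unique.Propositional using (Unique)
open import Relation.Binary.PropositionalEquality using (_≡_; _≢_)
open import Relation.Binary.Construct.Closure.ReflexiveTransitive using (Star)
open import Relation.Nullary using (¬_)
open import Function.Bundles using (_⇔_)

-- Nodes of the ambient graph: the distinguished starting node [[0,0]],
-- and the nodes [R,r] with 0 ≤ R,r ≤ k-1.
data Node (k : ℕ) : Set where
  start : Node k
  nd    : Fin k → Fin k → Node k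

fstN : {k : ℕ} → Node k → ℕ
fstN start    = 0
fstN (nd P p) = toℕ P

sndN : {k : ℕ} → Node k → ℕ
sndN start    = 0
sndN (nd P p) = toℕ p

data LEdge (g k : ℕ) : Node k → ℕ → ℕ → Node k → Set where
  edge : (u : Node k) (A a : ℕ) (R r : Fin k) →
         A < g → a < g →
         k * a + sndN u ≡ A + toℕ r * g →
         k * A + toℕ R ≡ a + fstN u * g →
         (u ≡ start → (A ≢ 0 × a ≢ 0)) →
         LEdge g k u A a (nd R r)

Edge : (g k : ℕ) → Node k → Node k → Set
Edge g k u v = ∃ λ A → ∃ λ a → LEdge g k u A a v

Reach : (g k : ℕ) → Node k → Node k → Set
Reach g k = Star (Edge g k)

InH : (g k : ℕ) → Node k → Set
InH g k v = Reach g k start v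

EvenPivot : (g k : ℕ) → Node k → Set
EvenPivot g k start    = Data.Empty.⊥ where import Data.Empty
EvenPivot g k (nd R r) = R ≡ r

OddPivot : (g k : ℕ) → Node k → Set
OddPivot g k start    = Data.Empty.⊥ where import Data.Empty
OddPivot g k (nd R r) = Edge g k (nd R r) (nd r R)

Pivot : (g k : ℕ) → Node k → Set
Pivot g k v = EvenPivot g k v ⊎ OddPivot g k v

InY : (g k : ℕ) → Node k → Set
InY g k v = InH g k v × (Pivot g k v ⊎ ∃ λ w → Reach g k v w × Pivot g k w)

EdgeY : (g k : ℕ) → Node k → Node k → Set
EdgeY g k u v = InY g k u × InY g k v × Edge g k u v

IsCompleteYoung : (g k m : ℕ) → Set
IsCompleteYoung g k m =
  InY g k start ×
  (Σ (List (Fin k × Fin k)) λ L →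
     length L ≡ m × Unique L ×
     ((R r : Fin k) → ((R , r) ∈ L) ⇔ InY g k (nd R r))) ×
  ((u v : Node k) → u ≢ start → v ≢ start →
     InY g k u → InY g k v → EdgeY g k u v) ×
  ((R r : Fin k) → ¬ (toℕ R ≡ 0 × toℕ r ≡ 0) → InY g k (nd R r) →
     EdgeY g k start (nd R r))

countS : (g k : ℕ) → ℕ
countS g k = length (filter (λ s → (k * k ∸ 1) ∣? (s * (g ∸ k)))
                            (map suc (upTo (k ∸ 1))))

module Submission where

-- Write k = 1 + k', g = k + e with k' ≥ 1, e ≥ 1, and D = k² − 1.  Call s admissible
-- when D ∣ s·e; countS g k counts the admissible s ∈ [1, k−1].
--
-- Multiplying one edge equation by k and adding
-- the other eliminates one label.  For an edge [t,t] → [R,r] this gives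
-- D·a + R = t·e + k·r·g, so if some h ∈ [1,k−1] is admissible then h·R ≡ h·r (mod D);
-- both sides are below D, hence R = r, and then D ∣ r·e.  Conversely, between
-- admissible diagonal nodes there is an edge with explicit labels.
--
-- Given an admissible h, every node of H(g,k) is an
-- admissible diagonal node [s,s] (invariant along paths), every such node is reached,
-- is an even pivot, and all of them are joined: Y(g,k) ∈ K_(1+count).  Conversely a
-- node ≠ [0,0] of a complete Young graph has an edge from the start and a self-loop;
-- these force R² ≡ r² (mod D), so R = r and r is an admissible witness.  Comparing the
-- duplicate-free node lists gives m = 1 + count, which is theorem4.

open import Defs
open import Data.Nat using (ℕ; zero; suc; _+_; _*_; _∸_; _≤_; _<_; z≤n; s≤s; _%_; NonZero; >-nonZero)
open import Data.Nat.Properties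
open import Data.Nat.DivMod using ([m+kn]%n≡m%n; m<n⇒m%n≡m)
open import Data.Nat.Divisibility using (_∣_; divides; _∣?_; _∣0; ∣m+n∣m⇒∣n; ∣m∣n⇒∣m+n; ∣n⇒∣m*n; m∣m*n)
open import Data.Nat.Tactic.RingSolver using (solve-∀)
open import Data.Fin as Fin using (Fin; toℕ; fromℕ<)
open import Data.Fin.Properties using (toℕ<n; toℕ-injective; toℕ-fromℕ<)
open import Data.Product using (Σ; ∃; _×_; _,_; proj₁; proj₂)
open import Data.Product.Properties using (≡-dec)
open import Data.Sum using (inj₁; inj₂)
open import Data.Bool using (true; false)
open import Data.Empty using (⊥-elim)
open import Data.List using (List; []; _∷_; length; filter; map; upTo; applyUpTo; tabulate; allFin)
open import Data.List.Properties using (length-map; map-upTo; map-tabulate; filter-accept)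
open import Data.List.Membership.Propositional using (_∈_)
open import Data.List.Membership.Propositional.Properties
  using (∈-filter⁺; ∈-filter⁻; ∈-map⁺; ∈-map⁻; ∈-upTo⁻; ∈-allFin)
open import Data.List.Membership.Propositional.Properties.WithK using (unique∧set⇒bag)
open import Data.List.Relation.Unary.Any using (here; there)
open import Data.List.Relation.Unary.All using (_∷_)
open import Data.List.Relation.Unary.AllPairs using (_∷_)
open import Data.List.Relation.Unary.Unique.Propositional using (Unique)
open import Data.List.Relation.Unary.Unique.Propositional.Properties using (map⁺; filter⁺; allFin⁺)
open import Data.List.Relation.Binary.BagAndSetEquality using (∼bag⇒↭)
open import Data.List.Relation.Binary.Permutation.Propositional.Properties using (↭-length)
open import Relation.Binary.PropositionalEquality
open import Relation.Binary.Definitions using (DecidableEquality; tri<; tri≈; tri>)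
open import Relation.Binary.Construct.Closure.ReflexiveTransitive using (ε; _◅_)
open import Relation.Nullary using (¬_; does; yes; no)
open import Relation.Unary using (Decidable)
open import Function using (_∘_; _$_)
open import Function.Bundles using (_⇔_; mk⇔; Equivalence)
import Function.Properties.Equivalence as ⇔

length-filter-map : ∀ {A B : Set} {P : B → Set} (P? : Decidable P) (f : A → B) (xs : List A) →
                    length (filter (P? ∘ f) xs) ≡ length (filter P? (map f xs))
length-filter-map P? f [] = refl
length-filter-map P? f (x ∷ xs) with does (P? (f x))
... | true  = cong suc (length-filter-map P? f xs)
... | false = length-filter-map P? f xs

tabulate-toℕ : ∀ {A : Set} (f : ℕ → A) n → tabulate {n = n} (f ∘ toℕ) ≡ applyUpTo f n
tabulate-toℕ f zero    = refl
tabulate-toℕ f (suc n) = cong (f 0 ∷_) (tabulate-toℕ (f ∘ suc) n)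

length-filter-allFin : ∀ {P : ℕ → Set} (P? : Decidable P) n → P 0 →
  length (filter (P? ∘ toℕ) (allFin (suc n))) ≡ suc (length (filter P? (map suc (upTo n))))
length-filter-allFin P? n P0 = begin
  length (filter (P? ∘ toℕ) (allFin (suc n)))      ≡⟨ length-filter-map P? toℕ (allFin (suc n)) ⟩
  length (filter P? (map toℕ (allFin (suc n))))    ≡⟨ cong (length ∘ filter P?) toℕ-list ⟩
  length (filter P? (0 ∷ map suc (upTo n)))        ≡⟨ cong length (filter-accept P? P0) ⟩
  suc (length (filter P? (map suc (upTo n))))      ∎
  where
  open ≡-Reasoning
  toℕ-list : map toℕ (allFin (suc n)) ≡ 0 ∷ map suc (upTo n)
  toℕ-list = trans (map-tabulate (λ i → i) toℕ)
                   (trans (tabulate-toℕ (λ i → i) (suc n)) (cong (0 ∷_) (sym (map-upTo suc n))))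

∈-of-nonempty : ∀ {A : Set} (xs : List A) {n} → length xs ≡ suc n → ∃ λ x → x ∈ xs
∈-of-nonempty (x ∷ _) _ = x , here refl

∃-other : ∀ {A : Set} → DecidableEquality A → {xs : List A} → Unique xs → 2 ≤ length xs →
          (x : A) → ∃ λ y → y ∈ xs × y ≢ x
∃-other _≟_ {y₁ ∷ y₂ ∷ _} ((y₁≢y₂ ∷ _) ∷ _) _ x with y₁ ≟ x
... | no y₁≢x  = y₁ , here refl , y₁≢x
... | yes refl = y₂ , there (here refl) , y₁≢y₂ ∘ sym
∃-other _≟_ {[]}         _ ()        _
∃-other _≟_ {_ ∷ []}     _ (s≤s ())  _

unique-same-length : ∀ {A : Set} {xs ys : List A} → Unique xs → Unique ys →
                     (∀ {z} → (z ∈ xs) ⇔ (z ∈ ys)) → length xs ≡ length ys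
unique-same-length xs! ys! same = ↭-length (∼bag⇒↭ (unique∧set⇒bag xs! ys! same))

residue-unique : ∀ {d} x y b c → x < d → y < d → x + b * d ≡ y + c * d → x ≡ y
residue-unique {suc d} x y b c x<d y<d eq = begin
  x                       ≡⟨ sym (m<n⇒m%n≡m x<d) ⟩
  x % suc d               ≡⟨ sym ([m+kn]%n≡m%n x b (suc d)) ⟩
  (x + b * suc d) % suc d ≡⟨ cong (_% suc d) eq ⟩
  (y + c * suc d) % suc d ≡⟨ [m+kn]%n≡m%n y c (suc d) ⟩
  y % suc d               ≡⟨ m<n⇒m%n≡m y<d ⟩
  y                       ∎
  where open ≡-Reasoning

square-injective : ∀ x y → x * x ≡ y * y → x ≡ y
square-injective x y eq with <-cmp x y
... | tri< x<y _ _ = ⊥-elim (<⇒≢ (*-mono-< x<y x<y) eq)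
... | tri≈ _ x≡y _ = x≡y
... | tri> _ _ y<x = ⊥-elim (>⇒≢ (*-mono-< y<x y<x) eq)

-- The arithmetic of the edge equations  k·a + p = A + r·g,  k·A + R = a + P·g
-- for k = 1 + k' ≥ 2, g = k + e and D = k² − 1.  Ring identities are proved by the
-- solver in fully quantified form (c stands for k', d for D where D is opaque).
module EdgeArithmetic (k' e : ℕ) (1≤k' : 1 ≤ k') where

  k : ℕ
  k = suc k'

  g : ℕ
  g = k + e

  -- k² − 1; note that k * k ∸ 1 reduces to this.
  D : ℕ
  D = k' + k' * k

  -- (k−1)² < k² − 1: products of two digits are residues modulo D.
  product-below-D : ∀ {x y} → x ≤ k' → y ≤ k' → x * y < D
  product-below-D {x} {y} x≤ y≤ = begin-strict
    x * y              ≤⟨ *-mono-≤ x≤ y≤ ⟩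
    k' * k'            <⟨ m<n+m (k' * k') (<-≤-trans 1≤k' (m≤m+n k' k')) ⟩
    k' + k' + k' * k'  ≡⟨ +-assoc k' k' (k' * k') ⟩
    k' + (k' + k' * k') ≡⟨ cong (k' +_) (sym (*-suc k' k')) ⟩
    D                  ∎
    where open ≤-Reasoning

  instance
    D-nonZero : NonZero D
    D-nonZero = >-nonZero (product-below-D {0} {0} z≤n z≤n)

  diagonal-step-eq : ∀ {t A a R r} → k * a + t ≡ A + r * g → k * A + R ≡ a + t * g →
                     D * a + R ≡ t * e + k * r * g
  diagonal-step-eq {t} {A} {a} {R} {r} e₁ e₂ = +-cancelʳ-≡ (a + k * t + k * A) _ _ (begin
    D * a + R + (a + k * t + k * A)         ≡⟨ left k' t A a R ⟩
    k * (k * a + t) + (k * A + R)           ≡⟨ cong₂ (λ x y → k * x + y) e₁ e₂ ⟩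
    k * (A + r * g) + (a + t * g)           ≡⟨ right k' e t A a r ⟩
    t * e + k * r * g + (a + k * t + k * A) ∎)
    where
    open ≡-Reasoning
    left : ∀ c t A a R → (c + c * suc c) * a + R + (a + suc c * t + suc c * A)
                         ≡ suc c * (suc c * a + t) + (suc c * A + R)
    left = solve-∀
    right : ∀ c e t A a r → suc c * (A + r * (suc c + e)) + (a + t * (suc c + e))
                            ≡ t * e + suc c * r * (suc c + e) + (a + suc c * t + suc c * A)
    right = solve-∀

  label-eq : ∀ {P p A a R r} → k * a + p ≡ A + r * g → k * A + R ≡ a + P * g →
             D * A + k * R + p ≡ r * g + k * P * g
  label-eq {P} {p} {A} {a} {R} {r} e₁ e₂ = +-cancelʳ-≡ (A + k * a) _ _ (begin
    D * A + k * R + p + (A + k * a)   ≡⟨ left k' p A a R ⟩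
    k * (k * A + R) + (k * a + p)     ≡⟨ cong₂ (λ x y → k * x + y) e₂ e₁ ⟩
    k * (a + P * g) + (A + r * g)     ≡⟨ right k' e P A a r ⟩
    r * g + k * P * g + (A + k * a)   ∎)
    where
    open ≡-Reasoning
    left : ∀ c p A a R → (c + c * suc c) * A + suc c * R + p + (A + suc c * a)
                         ≡ suc c * (suc c * A + R) + (suc c * a + p)
    left = solve-∀
    right : ∀ c e P A a r → suc c * (a + P * (suc c + e)) + (A + r * (suc c + e))
                            ≡ r * (suc c + e) + suc c * P * (suc c + e) + (A + suc c * a)
    right = solve-∀

  start-label-eq : ∀ {A a R r} → k * a + 0 ≡ A + r * g → k * A + R ≡ a + 0 →
                   D * A + k * R ≡ r * g
  start-label-eq {A} {a} {R} {r} e₁ e₂ = begin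
    D * A + k * R       ≡⟨ sym (+-identityʳ _) ⟩
    D * A + k * R + 0   ≡⟨ label-eq {0} {0} {A} {a} {R} {r} e₁ e₂ ⟩
    r * g + k * 0 * g   ≡⟨ cong (λ x → r * g + x * g) (*-zeroʳ k) ⟩
    r * g + 0           ≡⟨ +-identityʳ _ ⟩
    r * g               ∎
    where open ≡-Reasoning

  loop-label-eq : ∀ {A a R r} → k * a + r ≡ A + r * g → k * A + R ≡ a + R * g →
                  D * A + k * R + r ≡ (r + k * R) * g
  loop-label-eq {A} {a} {R} {r} e₁ e₂ = trans (label-eq {R} {r} {A} {a} {R} {r} e₁ e₂) (sym (*-distribʳ-+ g r (k * R)))

  -- If h ∈ [1,k'] has D ∣ h·e, a diagonal step cannot leave the diagonal:
  -- h·R ≡ h·r (mod D) with both sides below D.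
  target-diagonal : ∀ {h t a R r} → 1 ≤ h → h ≤ k' → R ≤ k' → r ≤ k' → D ∣ h * e →
                    D * a + R ≡ t * e + k * r * g → R ≡ r
  target-diagonal {h} {t} {a} {R} {r} (s≤s _) h≤ R≤ r≤ (divides q he≡qD) step =
    *-cancelˡ-≡ R r h (residue-unique (h * R) (h * r) (h * a) (h * r + t * q + k * r * q)
      (product-below-D h≤ R≤) (product-below-D h≤ r≤) (begin
        h * R + h * a * D                            ≡⟨ scale h D a R ⟩
        h * (D * a + R)                              ≡⟨ cong (h *_) step ⟩
        h * (t * e + k * r * g)                      ≡⟨ expand k' e h t r ⟩
        h * r + h * r * D + (t + k * r) * (h * e)    ≡⟨ cong (λ x → h * r + h * r * D + (t + k * r) * x) he≡qD ⟩
        h * r + h * r * D + (t + k * r) * (q * D)    ≡⟨ collect h r D t k q ⟩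
        h * r + (h * r + t * q + k * r * q) * D      ∎))
    where
    open ≡-Reasoning
    scale : ∀ h d a R → h * R + h * a * d ≡ h * (d * a + R)
    scale = solve-∀
    expand : ∀ c e h t r → h * (t * e + suc c * r * (suc c + e))
                           ≡ h * r + h * r * (c + c * suc c) + (t + suc c * r) * (h * e)
    expand = solve-∀
    collect : ∀ h r d t c q → h * r + h * r * d + (t + c * r) * (q * d)
                              ≡ h * r + (h * r + t * q + c * r * q) * d
    collect = solve-∀

  -- On a diagonal step into [r,r], admissibility passes from t to r (uses k² ≡ 1 mod D).
  target-admissible : ∀ {t a r} → D ∣ t * e → D * a + r ≡ t * e + k * r * g → D ∣ r * e
  target-admissible {t} {a} {r} D∣te step =
    ∣m+n∣m⇒∣n (subst (D ∣_) (sym multiple) (m∣m*n (k * a)))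
              (∣m∣n⇒∣m+n (∣n⇒∣m*n k D∣te) (m∣m*n (r * g)))
    where
    open ≡-Reasoning
    expand : ∀ c e t r → suc c * (t * e) + (c + c * suc c) * (r * (suc c + e)) + r * e + suc c * r
                         ≡ suc c * (t * e + suc c * r * (suc c + e))
    expand = solve-∀
    regroup : ∀ c d a r → c * (d * a + r) ≡ d * (c * a) + c * r
    regroup = solve-∀
    multiple : k * (t * e) + D * (r * g) + r * e ≡ D * (k * a)
    multiple = +-cancelʳ-≡ (k * r) _ _ (begin
      k * (t * e) + D * (r * g) + r * e + k * r ≡⟨ expand k' e t r ⟩
      k * (t * e + k * r * g)                   ≡⟨ cong (k *_) (sym step) ⟩
      k * (D * a + r)                           ≡⟨ regroup k D a r ⟩
      D * (k * a) + k * r                       ∎)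

  -- An edge from the start into [R,r] together with a self-loop at [R,r]:
  -- (r + kR)(D·A₀ + kR) = r(D·A₁ + kR + r) gives R² ≡ r² (mod D), hence R = r.
  loop-forces-diagonal : ∀ {A₀ A₁ R r} → R ≤ k' → r ≤ k' →
                         D * A₀ + k * R ≡ r * g → D * A₁ + k * R + r ≡ (r + k * R) * g → R ≡ r
  loop-forces-diagonal {A₀} {A₁} {R} {r} R≤ r≤ from-start self-loop =
    square-injective R r (residue-unique (R * R) (r * r) (A₀ * (r + k * R) + R * R) (r * A₁)
      (product-below-D R≤ R≤) (product-below-D r≤ r≤)
      (+-cancelʳ-≡ (r * k * R) _ _ (begin
        R * R + (A₀ * (r + k * R) + R * R) * D + r * k * R ≡⟨ expand₀ k' A₀ R r ⟩
        (r + k * R) * (D * A₀ + k * R)                     ≡⟨ cong ((r + k * R) *_) from-start ⟩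
        (r + k * R) * (r * g)                              ≡⟨ swap (r + k * R) r g ⟩
        r * ((r + k * R) * g)                              ≡⟨ cong (r *_) (sym self-loop) ⟩
        r * (D * A₁ + k * R + r)                           ≡⟨ expand₁ k D A₁ R r ⟩
        r * r + r * A₁ * D + r * k * R                     ∎)))
    where
    open ≡-Reasoning
    expand₀ : ∀ c A R r → R * R + (A * (r + suc c * R) + R * R) * (c + c * suc c) + r * suc c * R
                          ≡ (r + suc c * R) * ((c + c * suc c) * A + suc c * R)
    expand₀ = solve-∀
    swap : ∀ x r g → x * (r * g) ≡ r * (x * g)
    swap = solve-∀
    expand₁ : ∀ c d A R r → r * (d * A + c * R + r) ≡ r * r + r * A * d + r * c * R
    expand₁ = solve-∀

  start-target-admissible : ∀ {A r} → D * A + k * r ≡ r * g → D ∣ r * e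
  start-target-admissible {A} {r} from-start = divides A (+-cancelʳ-≡ (k * r) _ _ (begin
    r * e + k * r     ≡⟨ split k' e r ⟩
    r * g             ≡⟨ sym from-start ⟩
    D * A + k * r     ≡⟨ cong (_+ k * r) (*-comm D A) ⟩
    A * D + k * r     ∎))
    where
    open ≡-Reasoning
    split : ∀ c e r → r * e + suc c * r ≡ r * (suc c + e)
    split = solve-∀

  -- Labels for an edge [t,t] → [s,s] between admissible diagonal nodes, with
  -- s·e = q_s·D and t·e = q_t·D:  A = t + q_s + k·q_t,  a = s + q_t + k·q_s.
  connecting-eq : ∀ {t s qt qs} → s * e ≡ qs * D →
                  k * (s + qt + k * qs) + t ≡ (t + qs + k * qt) + s * g
  connecting-eq {t} {s} {qt} {qs} se≡ = +-cancelʳ-≡ (s * e) _ _ (begin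
    k * (s + qt + k * qs) + t + s * e           ≡⟨ expand k' e t qt s qs ⟩
    (t + qs + k * qt) + s * g + qs * D          ≡⟨ cong ((t + qs + k * qt) + s * g +_) (sym se≡) ⟩
    (t + qs + k * qt) + s * g + s * e           ∎)
    where
    open ≡-Reasoning
    expand : ∀ c e t qt s qs → suc c * (s + qt + suc c * qs) + t + s * e
                               ≡ (t + qs + suc c * qt) + s * (suc c + e) + qs * (c + c * suc c)
    expand = solve-∀

  connecting-label-bound : ∀ {t s qt qs} → t ≤ k' → s ≤ k' → s * e ≡ qs * D → t * e ≡ qt * D →
                           t + qs + k * qt < g
  connecting-label-bound {t} {s} {qt} {qs} t≤ s≤ se≡ te≡ = *-cancelʳ-< D _ _ (begin-strict
    (t + qs + k * qt) * D         ≡⟨ distribute t qs k qt D ⟩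
    t * D + qs * D + k * (qt * D) ≡⟨ cong₂ (λ x y → t * D + x + k * y) (sym se≡) (sym te≡) ⟩
    t * D + s * e + k * (t * e)   ≡⟨ regroup t D s e k ⟩
    t * D + (s + k * t) * e       <⟨ +-mono-<-≤ (*-monoˡ-< D (s≤s t≤)) (*-monoˡ-≤ e s+kt≤D) ⟩
    k * D + D * e                 ≡⟨ factor k D e ⟩
    g * D                         ∎)
    where
    open ≤-Reasoning
    s+kt≤D : s + k * t ≤ D
    s+kt≤D = ≤-trans (+-mono-≤ s≤ (*-monoʳ-≤ k t≤)) (≤-reflexive (cong (k' +_) (*-comm k k')))
    distribute : ∀ t qs c qt d → (t + qs + c * qt) * d ≡ t * d + qs * d + c * (qt * d)
    distribute = solve-∀
    regroup : ∀ t d s e c → t * d + s * e + c * (t * e) ≡ t * d + (s + c * t) * e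
    regroup = solve-∀
    factor : ∀ c d e → c * d + d * e ≡ (c + e) * d
    factor = solve-∀

module YoungGraph (k' e : ℕ) (1≤k' : 1 ≤ k') (1≤e : 1 ≤ e) where
  open EdgeArithmetic k' e 1≤k'

  Admissible : ℕ → Set
  Admissible s = D ∣ s * e

  admissible? : Decidable Admissible
  admissible? s = D ∣? s * e

  admissible-0 : Admissible 0
  admissible-0 = D ∣0

  count : ℕ
  count = length (filter admissible? (map suc (upTo k')))

  countS≡count : countS g k ≡ count
  countS≡count = cong (λ x → length (filter (λ s → D ∣? s * x) (map suc (upTo k')))) (m+n∸m≡n k e)

  record Witness : Set where
    constructor witness
    field
      h            : ℕ
      1≤h          : 1 ≤ h
      h≤k'         : h ≤ k'
      admissible-h : Admissible h

  count-witness : ∀ {n} → count ≡ suc n → Witness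
  count-witness eq with ∈-of-nonempty (filter admissible? (map suc (upTo k'))) eq
  ... | x , x∈ with ∈-filter⁻ admissible? {xs = map suc (upTo k')} x∈
  ... | x∈map , adm with ∈-map⁻ suc {xs = upTo k'} x∈map
  ... | y , y∈ , refl = witness (suc y) (s≤s z≤n) (∈-upTo⁻ y∈) adm

  digit≤ : (R : Fin k) → toℕ R ≤ k'
  digit≤ R = ≤-pred (toℕ<n R)

  sndN≤ : (u : Node k) → sndN u ≤ k'
  sndN≤ start    = z≤n
  sndN≤ (nd _ r) = digit≤ r

  -- Needed to see that edges out of the start have nonzero labels.
  product-nonzero : ∀ {x y} → 1 ≤ x → 1 ≤ y → x * y ≢ 0
  product-nonzero {suc _} {suc _} _ _ ()

  Balanced : Node k → Set
  Balanced v = fstN v ≡ sndN v × Admissible (sndN v)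

  start-balanced : Balanced start
  start-balanced = refl , admissible-0

  diagonal-edge : (u : Node k) → Balanced u → (S : Fin k) → Admissible (toℕ S) →
                  (u ≡ start → 1 ≤ toℕ S) → Edge g k u (nd S S)
  diagonal-edge u (P≡t , divides qt te≡) S (divides qs se≡) 1≤S =
    A , a , edge u A a S S
      (connecting-label-bound (sndN≤ u) (digit≤ S) se≡ te≡)
      (connecting-label-bound (digit≤ S) (sndN≤ u) te≡ se≡)
      (connecting-eq {t} {s} {qt} {qs} se≡)
      (subst (λ P → k * A + s ≡ a + P * g) (sym P≡t) (connecting-eq {s} {t} {qs} {qt} te≡))
      labels-nonzero
    where
    t = sndN u
    s = toℕ S
    A = t + qs + k * qt
    a = s + qt + k * qs
    labels-nonzero : u ≡ start → A ≢ 0 × a ≢ 0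
    labels-nonzero u≡start =
      (λ A≡0 → product-nonzero (1≤S u≡start) 1≤e
                 (trans se≡ (cong (_* D) (m+n≡0⇒n≡0 t (m+n≡0⇒m≡0 (t + qs) A≡0))))) ,
      (λ a≡0 → <⇒≢ (1≤S u≡start) (sym (m+n≡0⇒m≡0 s (m+n≡0⇒m≡0 (s + qt) a≡0))))

  loop-witness : (R r : Fin k) → ¬ (toℕ R ≡ 0 × toℕ r ≡ 0) →
                 Edge g k start (nd R r) → Edge g k (nd R r) (nd R r) → Witness
  loop-witness R r not-origin (A₀ , a₀ , edge _ _ _ _ _ _ _ s₁ s₂ _)
                              (A₁ , a₁ , edge _ _ _ _ _ _ _ l₁ l₂ _) =
    witness (toℕ r) 1≤r (digit≤ r) $
    start-target-admissible (subst (λ x → D * A₀ + k * x ≡ toℕ r * g) R≡r start-eq)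
    where
    start-eq : D * A₀ + k * toℕ R ≡ toℕ r * g
    start-eq = start-label-eq {A₀} {a₀} {toℕ R} {toℕ r} s₁ s₂
    R≡r : toℕ R ≡ toℕ r
    R≡r = loop-forces-diagonal (digit≤ R) (digit≤ r) start-eq
                               (loop-label-eq {A₁} {a₁} {toℕ R} {toℕ r} l₁ l₂)
    1≤r : 1 ≤ toℕ r
    1≤r = n≢0⇒n>0 (λ r≡0 → not-origin (trans R≡r r≡0 , r≡0))

  module Classification (w : Witness) where
    open Witness w

    edge-balanced : ∀ {u v} → Edge g k u v → Balanced u → Balanced v
    edge-balanced (A , a , edge u _ _ R r _ _ e₁ e₂ _) (P≡t , adm-t) =
      R≡r , target-admissible {sndN u} {a} {toℕ r} adm-t
              (subst (λ x → D * a + x ≡ sndN u * e + k * toℕ r * g) R≡r step)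
      where
      step : D * a + toℕ R ≡ sndN u * e + k * toℕ r * g
      step = diagonal-step-eq {sndN u} {A} {a} {toℕ R} {toℕ r} e₁
               (subst (λ P → k * A + toℕ R ≡ a + P * g) P≡t e₂)
      R≡r : toℕ R ≡ toℕ r
      R≡r = target-diagonal {h} {sndN u} {a} {toℕ R} {toℕ r} 1≤h h≤k' (digit≤ R) (digit≤ r)
                            admissible-h step

    reach-balanced : ∀ {u v} → Reach g k u v → Balanced u → Balanced v
    reach-balanced ε        b = b
    reach-balanced (x ◅ xs) b = reach-balanced xs (edge-balanced x b)

    InY⇒balanced : ∀ {v} → InY g k v → Balanced v
    InY⇒balanced (reach , _) = reach-balanced reach start-balanced

    InY⇒diagonal : ∀ {R r} → InY g k (nd R r) → R ≡ r
    InY⇒diagonal y = toℕ-injective (proj₁ (InY⇒balanced y))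

    hub : Fin k
    hub = fromℕ< (s≤s h≤k')

    edge-to-hub : Edge g k start (nd hub hub)
    edge-to-hub = diagonal-edge start start-balanced hub
      (subst Admissible (sym toℕ-hub) admissible-h)
      (λ _ → subst (1 ≤_) (sym toℕ-hub) 1≤h)
      where
      toℕ-hub : toℕ hub ≡ h
      toℕ-hub = toℕ-fromℕ< _

    -- Every admissible diagonal node lies in Y (via the hub when it is [0,0]).
    diagonal-in-Y : (r : Fin k) → Admissible (toℕ r) → InY g k (nd r r)
    diagonal-in-Y r adm = reach-r , inj₁ (inj₁ refl)
      where
      reach-r : InH g k (nd r r)
      reach-r with toℕ r ≟ 0
      ... | no r≢0 = diagonal-edge start start-balanced r adm (λ _ → n≢0⇒n>0 r≢0) ◅ ε
      ... | yes _  = edge-to-hub ◅ diagonal-edge (nd hub hub) (edge-balanced edge-to-hub start-balanced)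
                                                 r adm (λ ()) ◅ ε

    start-in-Y : InY g k start
    start-in-Y = ε , inj₂ (nd hub hub , edge-to-hub ◅ ε , inj₁ refl)

    all-edges : (u v : Node k) → u ≢ start → v ≢ start → InY g k u → InY g k v → EdgeY g k u v
    all-edges start    _        u≢start _       _ _ = ⊥-elim (u≢start refl)
    all-edges (nd _ _) start    _       v≢start _ _ = ⊥-elim (v≢start refl)
    all-edges (nd R r) (nd S s) _       _       yu yv with InY⇒diagonal yu | InY⇒diagonal yv
    ... | refl | refl =
      yu , yv , diagonal-edge (nd R R) (InY⇒balanced yu) S (proj₂ (InY⇒balanced yv)) (λ ())

    start-edges : (R r : Fin k) → ¬ (toℕ R ≡ 0 × toℕ r ≡ 0) → InY g k (nd R r) → EdgeY g k start (nd R r)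
    start-edges R r not-origin y with InY⇒diagonal y
    ... | refl = start-in-Y , y , diagonal-edge start start-balanced R (proj₂ (InY⇒balanced y))
                                   (λ _ → n≢0⇒n>0 (λ R≡0 → not-origin (R≡0 , R≡0)))

    diag : Fin k → Fin k × Fin k
    diag i = i , i

    nodes : List (Fin k × Fin k)
    nodes = map diag (filter (admissible? ∘ toℕ) (allFin k))

    nodes-unique : Unique nodes
    nodes-unique = map⁺ (cong proj₁) (filter⁺ (admissible? ∘ toℕ) (allFin⁺ k))

    nodes-length : length nodes ≡ suc count
    nodes-length = trans (length-map diag (filter (admissible? ∘ toℕ) (allFin k)))
                         (length-filter-allFin admissible? k' admissible-0)

    ∈nodes⇔InY : (R r : Fin k) → ((R , r) ∈ nodes) ⇔ InY g k (nd R r)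
    ∈nodes⇔InY R r = mk⇔ to from
      where
      to : (R , r) ∈ nodes → InY g k (nd R r)
      to p with ∈-map⁻ diag p
      ... | i , i∈ , refl = diagonal-in-Y i (proj₂ (∈-filter⁻ (admissible? ∘ toℕ) {xs = allFin k} i∈))
      from : InY g k (nd R r) → (R , r) ∈ nodes
      from y with InY⇒diagonal y
      ... | refl = ∈-map⁺ diag (∈-filter⁺ (admissible? ∘ toℕ) (∈-allFin R) (proj₂ (InY⇒balanced y)))

    complete : IsCompleteYoung g k (suc count)
    complete = start-in-Y , (nodes , nodes-length , nodes-unique , ∈nodes⇔InY) , all-edges , start-edges

  not-origin : {L : List (Fin k × Fin k)} → Unique L → 2 ≤ length L →
               Σ (Fin k) λ R → Σ (Fin k) λ r → (R , r) ∈ L × ¬ (toℕ R ≡ 0 × toℕ r ≡ 0)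
  not-origin L! 2≤L with ∃-other (≡-dec Fin._≟_ Fin._≟_) L! 2≤L (Fin.zero , Fin.zero)
  ... | (R , r) , ∈L , ≢origin =
    R , r , ∈L , λ (R≡0 , r≡0) → ≢origin (cong₂ _,_ (toℕ-injective R≡0) (toℕ-injective r≡0))

  characterisation : ∀ m → 2 ≤ m → IsCompleteYoung g k m ⇔ (count ≡ m ∸ 1)
  characterisation (suc (suc m)) _ = mk⇔ necessity sufficiency
    where
    necessity : IsCompleteYoung g k (2 + m) → count ≡ suc m
    necessity (_ , (L , L-length , L! , ∈L⇔InY) , all-edges , start-edges)
      with not-origin L! (subst (2 ≤_) (sym L-length) (s≤s (s≤s z≤n)))
    ... | R , r , ∈L , R,r≢0 = suc-injective (trans (sym nodes-length) (trans (sym same-length) L-length))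
      where
      y : InY g k (nd R r)
      y = Equivalence.to (∈L⇔InY R r) ∈L
      w : Witness
      w = loop-witness R r R,r≢0 (proj₂ (proj₂ (start-edges R r R,r≢0 y)))
                                 (proj₂ (proj₂ (all-edges (nd R r) (nd R r) (λ ()) (λ ()) y y)))
      open Classification w using (nodes; nodes-length; nodes-unique; ∈nodes⇔InY)
      same-members : ∀ z → (z ∈ L) ⇔ (z ∈ nodes)
      same-members (S , s) = ⇔.trans (∈L⇔InY S s) (⇔.sym (∈nodes⇔InY S s))
      same-length : length L ≡ length nodes
      same-length = unique-same-length L! nodes-unique (λ {z} → same-members z)
    sufficiency : count ≡ suc m → IsCompleteYoung g k (2 + m)
    sufficiency c = subst (IsCompleteYoung g k) (cong suc c) (Classification.complete (count-witness c))
  characterisation 0             ()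
  characterisation 1             (s≤s ())

theorem4 : (g k m : ℕ) → 2 ≤ k → k < g → 2 ≤ m →
    IsCompleteYoung g k m ⇔ (countS g k ≡ m ∸ 1)
theorem4 g (suc k') m (s≤s 1≤k') k<g 2≤m with m≤n⇒∃[o]m+o≡n k<g
... | o , k+1+o≡g with trans (+-suc (suc k') o) k+1+o≡g
... | refl = subst (λ c → IsCompleteYoung g (suc k') m ⇔ (c ≡ m ∸ 1)) (sym countS≡count)
                   (characterisation m 2≤m)
  where open YoungGraph k' (suc o) 1≤k' (s≤s z≤n)
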